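{- Let $n\geq 4$ be prime, let $G_n=\mathbb{Z}_n\times\mathbb{Z}_n$, let $S=\{(i,0),(0,i),(i,i): 1\leq i\leq n-1\}\subset G_n$, and let $\Gamma(n)=\mathrm{Cay}(G_n;S)$ (vertices $G_n$, $g\sim h$ iff $h-g\in S$). Then $\Gamma(n)$ is arc-transitive.
   Context: A graph $\Gamma$ is arc-transitive if for all vertices $u,v,x,y$ with $u\sim v$ and $x\sim y$ there is an automorphism $\pi$ of $\Gamma$ with $\pi(u)=x$ and $\pi(v)=y$. -}

module Defs where

open import Data.Nat using (ℕ; zero; suc; _+_; _∸_; _≤_; _≤ᵇ_)
open import Data.Fin using (Fin; toℕ)
open import Data.Bool using (if_then_else_)
open import Data.Product using (Σ; _×_; _,_)
open import Data.Sum using (_⊎_)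
open import Relation.Binary.PropositionalEquality using (_≡_)
open import Function.Bundles using (_⤖_; Bijection; _⇔_)

G : ℕ → Set
G n = Fin n × Fin n

diffℤn : {n : ℕ} → Fin n → Fin n → ℕ
diffℤn {n} a b = if toℕ a ≤ᵇ toℕ b then toℕ b ∸ toℕ a else (n + toℕ b) ∸ toℕ a

diffG : {n : ℕ} → G n → G n → ℕ × ℕ
diffG (g₁ , g₂) (h₁ , h₂) = diffℤn g₁ h₁ , diffℤn g₂ h₂

InS : ℕ → ℕ × ℕ → Set
InS n d = Σ ℕ λ i → (1 ≤ i) × (i ≤ n ∸ 1) ×
            ((d ≡ (i , 0)) ⊎ (d ≡ (0 , i)) ⊎ (d ≡ (i , i)))

Adj : (n : ℕ) → G n → G n → Set
Adj n g h = InS n (diffG g h)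

IsAutomorphism : {V : Set} → (V → V → Set) → (V ⤖ V) → Set
IsAutomorphism {V} _∼_ π = ∀ (u v : V) → (u ∼ v) ⇔ (Bijection.to π u ∼ Bijection.to π v)

ArcTransitive : {V : Set} → (V → V → Set) → Set
ArcTransitive {V} _∼_ = ∀ (u v x y : V) → u ∼ v → x ∼ y →
  Σ (V ⤖ V) λ π → IsAutomorphism _∼_ π × (Bijection.to π u ≡ x) × (Bijection.to π v ≡ y)

{-# OPTIONS --safe #-}
-- Γ(n) is the Cayley graph of ℤₙ² whose connection set consists of the nonzero points of the
-- three lines x₂ = 0, x₁ = 0 and x₁ = x₂. Translations, the scalings x ↦ x·i by units i (every
-- nonzero i, as n is prime), the coordinate swap and the shear (x₁, x₂) ↦ (x₁, x₁ − x₂) are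
-- automorphisms; swap and shear carry the first line onto the other two. So every arc (a, b)
-- is the image of the base arc ((0,0), (1,0)) under x ↦ δ(x)·i + a, where δ ∈ {id, swap, shear}
-- moves (1,0) onto the line of b − a and i is the step along it; composing one such map with
-- the inverse of another sends any arc to any other.
-- Residues are natural numbers up to congruence modulo n = suc m, with m playing the role of −1.
module Submission where

open import Defs
open import Data.Nat using (ℕ; _≤_)
open import Data.Nat.Primality using (Prime)

open import Data.Nat using (zero; suc; _+_; _*_; _∸_; _<_; _≤ᵇ_; _%_; z≤n; s≤s; s≤s⁻¹)
open import Data.Nat.Properties
  using (+-comm; +-assoc; +-identityʳ; *-comm; *-assoc; *-identityʳ; *-suc; *-distribʳ-+;
         ≤ᵇ-reflects-≤; ≰⇒>; ≤-trans; <⇒≤; m≤m+n; m∸n≤m; ≤-<-trans; <⇒≢; m∸n+n≡m; +-cancelʳ-<; +-monoʳ-<;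
         +-commutativeSemigroup)
open import Data.Nat.DivMod
  using (_mod_; m%n<n; m%n%n≡m%n; n%n≡0; [m+kn]%n≡m%n; m*n%n≡0; m<n⇒m%n≡m; %-distribˡ-+; %-distribˡ-*)
open import Data.Fin using (Fin; toℕ)
open import Data.Fin.Properties using (toℕ-injective; toℕ<n; toℕ-fromℕ<)
open import Data.Product using (Σ-syntax; _×_; _,_; proj₁; proj₂; map; swap)
open import Data.Product.Relation.Binary.Pointwise.NonDependent using (Pointwise; ×-setoid)
open import Data.Sum using (inj₁; inj₂)
open import Level using (0ℓ)
open import Function using (_∘_)
open import Relation.Nullary using (¬_)
open import Relation.Nullary.Reflects using (ofʸ; ofⁿ)
open import Relation.Binary using (IsEquivalence; Setoid)
open import Relation.Binary.PropositionalEquality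
  using (_≡_; refl; sym; trans; cong; cong₂; subst; subst₂; module ≡-Reasoning)
open import Function.Bundles using (_↔_; mk↔ₛ′; mk⇔)
open import Function.Properties.Inverse using (↔⇒⤖)
open import Data.Nat.Coprimality using (prime⇒coprime; coprime-Bézout)
open import Data.Nat.GCD using (module Bézout)
open import Data.Empty using (⊥-elim)
open import Data.Bool using (true; false)
open import Algebra.Properties.CommutativeSemigroup +-commutativeSemigroup using (interchange; x∙yz≈y∙xz)
import Relation.Binary.Reasoning.Setoid as SetoidReasoning

module Modulo (m : ℕ) where

  n : ℕ
  n = suc m

  infix 4 _≈_ _≉_

  record _≈_ (a b : ℕ) : Set where
    constructor mk≈
    field %-≡ : a % n ≡ b % n

  _≉_ : ℕ → ℕ → Set
  a ≉ b = ¬ a ≈ b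

  ≈-isEquivalence : IsEquivalence _≈_
  ≈-isEquivalence = record
    { refl  = mk≈ refl
    ; sym   = λ (mk≈ p) → mk≈ (sym p)
    ; trans = λ (mk≈ p) (mk≈ q) → mk≈ (trans p q)
    }

  ≈-setoid : Setoid 0ℓ 0ℓ
  ≈-setoid = record { isEquivalence = ≈-isEquivalence }

  open IsEquivalence ≈-isEquivalence public
    using () renaming (refl to ≈-refl; sym to ≈-sym; trans to ≈-trans; reflexive to ≡⇒≈)

  +-cong : ∀ {a b c d} → a ≈ b → c ≈ d → a + c ≈ b + d
  +-cong {a} {b} {c} {d} (mk≈ p) (mk≈ q) = mk≈ (begin
    (a + c) % n              ≡⟨ %-distribˡ-+ a c n ⟩
    (a % n + c % n) % n      ≡⟨ cong₂ (λ x y → (x + y) % n) p q ⟩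
    (b % n + d % n) % n      ≡⟨ %-distribˡ-+ b d n ⟨
    (b + d) % n              ∎)
    where open ≡-Reasoning

  *-cong : ∀ {a b c d} → a ≈ b → c ≈ d → a * c ≈ b * d
  *-cong {a} {b} {c} {d} (mk≈ p) (mk≈ q) = mk≈ (begin
    (a * c) % n              ≡⟨ %-distribˡ-* a c n ⟩
    (a % n * (c % n)) % n    ≡⟨ cong₂ (λ x y → (x * y) % n) p q ⟩
    (b % n * (d % n)) % n    ≡⟨ %-distribˡ-* b d n ⟨
    (b * d) % n              ∎)
    where open ≡-Reasoning

  a%n≈a : ∀ a → a % n ≈ a
  a%n≈a a = mk≈ (m%n%n≡m%n a n)

  a+kn≈a : ∀ a k → a + k * n ≈ a
  a+kn≈a a k = mk≈ ([m+kn]%n≡m%n a k n)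

  n*a≈0 : ∀ a → n * a ≈ 0
  n*a≈0 a = mk≈ (trans (cong (_% n) (*-comm n a)) (m*n%n≡0 a n))

  open SetoidReasoning ≈-setoid

  +-cancelʳ-≈ : ∀ {a b} c → a + c ≈ b + c → a ≈ b
  +-cancelʳ-≈ {a} {b} c a+c≈b+c = begin
    a                    ≡⟨ +-identityʳ a ⟨
    a + 0                ≈⟨ +-cong (≈-refl {a}) (n*a≈0 c) ⟨
    a + (c + m * c)      ≡⟨ +-assoc a c (m * c) ⟨
    (a + c) + m * c      ≈⟨ +-cong a+c≈b+c ≈-refl ⟩
    (b + c) + m * c      ≡⟨ +-assoc b c (m * c) ⟩
    b + (c + m * c)      ≈⟨ +-cong (≈-refl {b}) (n*a≈0 c) ⟩
    b + 0                ≡⟨ +-identityʳ b ⟩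
    b                    ∎

  n≈0 : n ≈ 0
  n≈0 = mk≈ (n%n≡0 n)

  a+1≈0⇒a≈m : ∀ {a} → a + 1 ≈ 0 → a ≈ m
  a+1≈0⇒a≈m {a} a+1≈0 = +-cancelʳ-≈ 1 (begin
    a + 1    ≈⟨ a+1≈0 ⟩
    0        ≈⟨ n≈0 ⟨
    n        ≡⟨ +-comm m 1 ⟨
    m + 1    ∎)

  m*m≈1 : m * m ≈ 1
  m*m≈1 = +-cancelʳ-≈ m (begin
    m * m + m    ≡⟨ +-comm (m * m) m ⟩
    m + m * m    ≡⟨ *-suc m m ⟨
    m * n        ≈⟨ a+kn≈a 0 m ⟩
    0            ≈⟨ n≈0 ⟨
    1 + m        ∎)

  <n-≈⇒≡ : ∀ {a b} → a < n → b < n → a ≈ b → a ≡ b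
  <n-≈⇒≡ a<n b<n (mk≈ p) = trans (sym (m<n⇒m%n≡m a<n)) (trans p (m<n⇒m%n≡m b<n))

  ⟦_⟧ : ℕ → Fin n
  ⟦ a ⟧ = a mod n

  toℕ-⟦⟧ : ∀ a → toℕ ⟦ a ⟧ ≈ a
  toℕ-⟦⟧ a = ≈-trans (≡⇒≈ (toℕ-fromℕ< (m%n<n a n))) (a%n≈a a)

  toℕ-≈⇒≡ : ∀ {x y : Fin n} → toℕ x ≈ toℕ y → x ≡ y
  toℕ-≈⇒≡ {x} {y} p = toℕ-injective (<n-≈⇒≡ (toℕ<n x) (toℕ<n y) p)

  ⟦⟧-unique : ∀ {a} {x : Fin n} → a ≈ toℕ x → ⟦ a ⟧ ≡ x
  ⟦⟧-unique {a} p = toℕ-≈⇒≡ (≈-trans (toℕ-⟦⟧ a) p)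

  diffℤn-+ : ∀ (a b : Fin n) → diffℤn a b + toℕ a ≈ toℕ b
  diffℤn-+ a b with toℕ a ≤ᵇ toℕ b | ≤ᵇ-reflects-≤ (toℕ a) (toℕ b)
  ... | true  | ofʸ a≤b = ≡⇒≈ (m∸n+n≡m a≤b)
  ... | false | ofⁿ _   = begin
    (n + toℕ b) ∸ toℕ a + toℕ a   ≡⟨ m∸n+n≡m (≤-trans (<⇒≤ (toℕ<n a)) (m≤m+n n (toℕ b))) ⟩
    n + toℕ b                     ≈⟨ +-cong n≈0 ≈-refl ⟩
    toℕ b                         ∎

  diffℤn<n : ∀ (a b : Fin n) → diffℤn a b < n
  diffℤn<n a b with toℕ a ≤ᵇ toℕ b | ≤ᵇ-reflects-≤ (toℕ a) (toℕ b)
  ... | true  | ofʸ _   = ≤-<-trans (m∸n≤m (toℕ b) (toℕ a)) (toℕ<n b)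
  ... | false | ofⁿ a≰b = +-cancelʳ-< (toℕ a) _ n
    (subst (_< n + toℕ a) (sym (m∸n+n≡m (≤-trans (<⇒≤ (toℕ<n a)) (m≤m+n n (toℕ b)))))
           (+-monoʳ-< n (≰⇒> a≰b)))

  diffℤn-unique : ∀ {d} (a b : Fin n) → d < n → d + toℕ a ≈ toℕ b → diffℤn a b ≡ d
  diffℤn-unique a b d<n d+a≈b =
    <n-≈⇒≡ (diffℤn<n a b) d<n (+-cancelʳ-≈ (toℕ a) (≈-trans (diffℤn-+ a b) (≈-sym d+a≈b)))

  diffℤn≡⇒+≈ : ∀ {i} (a b : Fin n) → diffℤn a b ≡ i → i + toℕ a ≈ toℕ b
  diffℤn≡⇒+≈ a b refl = diffℤn-+ a b

  diffℤn-positive : ∀ (a b : Fin n) → toℕ a ≉ toℕ b → 1 ≤ diffℤn a b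
  diffℤn-positive a b a≉b with diffℤn a b | diffℤn-+ a b
  ... | zero  | a≈b = ⊥-elim (a≉b a≈b)
  ... | suc _ | _   = s≤s z≤n

  +-≈⇒≉ : ∀ {i a b} → 1 ≤ i → i ≤ m → i + a ≈ b → a ≉ b
  +-≈⇒≉ {i} {a} 1≤i i≤m i+a≈b a≈b = <⇒≢ 1≤i (sym i≡0)
    where
    i≡0 : i ≡ 0
    i≡0 = <n-≈⇒≡ (s≤s i≤m) (s≤s z≤n) (+-cancelʳ-≈ a (≈-trans i+a≈b (≈-sym a≈b)))

  infixl 6 _⊖_

  _⊖_ : ℕ → ℕ → ℕ
  b ⊖ a = b + a * m

  ⊖-+ : ∀ a b → b ⊖ a + a ≈ b
  ⊖-+ a b = begin
    b + a * m + a      ≡⟨ +-assoc b (a * m) a ⟩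
    b + (a * m + a)    ≡⟨ cong (b +_) (trans (+-comm (a * m) a) (cong (a +_) (*-comm a m))) ⟩
    b + n * a          ≈⟨ +-cong (≈-refl {b}) (n*a≈0 a) ⟩
    b + 0              ≡⟨ +-identityʳ b ⟩
    b                  ∎

  ⊖≉0 : ∀ {a b} → a ≉ b → b ⊖ a ≉ 0
  ⊖≉0 {a} {b} a≉b b⊖a≈0 = a≉b (begin
    a            ≈⟨ +-cong b⊖a≈0 (≈-refl {a}) ⟨
    b ⊖ a + a    ≈⟨ ⊖-+ a b ⟩
    b            ∎)

  ⊖-involutive : ∀ a b → a ⊖ (a ⊖ b) ≈ b
  ⊖-involutive a b = +-cancelʳ-≈ (a ⊖ b) (begin
    a ⊖ (a ⊖ b) + (a ⊖ b)    ≈⟨ ⊖-+ (a ⊖ b) a ⟩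
    a                        ≈⟨ ⊖-+ b a ⟨
    a ⊖ b + b                ≡⟨ +-comm (a ⊖ b) b ⟩
    b + (a ⊖ b)              ∎)

  1*i+a≈b : ∀ i {a b} → i + a ≈ b → 1 * i + a ≈ b
  1*i+a≈b i {a} i+a≈b = ≈-trans (≡⇒≈ (cong (_+ a) (+-identityʳ i))) i+a≈b

  +-≈-transfer : ∀ {i a₁ a₂ b₁ b₂} → i + a₁ ≈ b₁ → a₁ + b₂ ≈ b₁ + a₂ → i + a₂ ≈ b₂
  +-≈-transfer {i} {a₁} {a₂} {b₁} {b₂} i+a₁≈b₁ a₁+b₂≈b₁+a₂ = +-cancelʳ-≈ a₁ (begin
    i + a₂ + a₁      ≡⟨ +-assoc i a₂ a₁ ⟩
    i + (a₂ + a₁)    ≡⟨ cong (i +_) (+-comm a₂ a₁) ⟩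
    i + (a₁ + a₂)    ≡⟨ +-assoc i a₁ a₂ ⟨
    i + a₁ + a₂      ≈⟨ +-cong i+a₁≈b₁ ≈-refl ⟩
    b₁ + a₂          ≈⟨ a₁+b₂≈b₁+a₂ ⟨
    a₁ + b₂          ≡⟨ +-comm a₁ b₂ ⟩
    b₂ + a₁          ∎)

  +-≈-cross : ∀ {i a₁ a₂ b₁ b₂} → i + a₁ ≈ b₁ → i + a₂ ≈ b₂ → a₁ + b₂ ≈ b₁ + a₂
  +-≈-cross {i} {a₁} {a₂} {b₁} {b₂} i+a₁≈b₁ i+a₂≈b₂ = begin
    a₁ + b₂          ≈⟨ +-cong (≈-refl {a₁}) i+a₂≈b₂ ⟨
    a₁ + (i + a₂)    ≡⟨ x∙yz≈y∙xz a₁ i a₂ ⟩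
    i + (a₁ + a₂)    ≡⟨ +-assoc i a₁ a₂ ⟨
    i + a₁ + a₂      ≈⟨ +-cong i+a₁≈b₁ ≈-refl ⟩
    b₁ + a₂          ∎

  +-≈-cross⇒⊖-≈ : ∀ {a₁ a₂ b₁ b₂} → a₁ + b₂ ≈ b₁ + a₂ → a₁ ⊖ a₂ ≈ b₁ ⊖ b₂
  +-≈-cross⇒⊖-≈ {a₁} {a₂} {b₁} {b₂} a₁+b₂≈b₁+a₂ = +-cancelʳ-≈ b₂
    (≈-trans (+-≈-transfer (⊖-+ a₂ a₁) a₂+b₁≈a₁+b₂) (≈-sym (⊖-+ b₂ b₁)))
    where
    a₂+b₁≈a₁+b₂ : a₂ + b₁ ≈ a₁ + b₂
    a₂+b₁≈a₁+b₂ = ≈-sym (≈-trans a₁+b₂≈b₁+a₂ (≡⇒≈ (+-comm b₁ a₂)))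

  prime⇒invertible-suc : Prime n → ∀ {r} → suc r < n → Σ[ j ∈ ℕ ] j * suc r ≈ 1
  prime⇒invertible-suc p {r} r<n with coprime-Bézout (prime⇒coprime p r<n)
  -- In this case y * suc r ≈ −1 ≈ m, so m * y inverts suc r.
  ... | Bézout.+- x y 1+yr≡xn = m * y , (begin
    m * y * suc r      ≡⟨ *-assoc m y (suc r) ⟩
    m * (y * suc r)    ≈⟨ *-cong (≈-refl {m}) (a+1≈0⇒a≈m yr+1≈0) ⟩
    m * m              ≈⟨ m*m≈1 ⟩
    1                  ∎)
    where
    yr+1≈0 : y * suc r + 1 ≈ 0
    yr+1≈0 = ≈-trans (≡⇒≈ (trans (+-comm (y * suc r) 1) 1+yr≡xn)) (a+kn≈a 0 x)
  ... | Bézout.-+ x y 1+xn≡yr = y , ≈-trans (≡⇒≈ (sym 1+xn≡yr)) (a+kn≈a 1 x)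

  prime⇒invertible : Prime n → ∀ {i} → i ≉ 0 → Σ[ j ∈ ℕ ] j * i ≈ 1
  prime⇒invertible p {i} i≉0 with i % n in i%n≡r
  ... | zero  = ⊥-elim (i≉0 (mk≈ i%n≡r))
  ... | suc r =
    let j , jr≈1 = prime⇒invertible-suc p (subst (_< n) i%n≡r (m%n<n i n))
    in j , ≈-trans (*-cong (≈-refl {j}) (≈-trans (≈-sym (a%n≈a i)) (≡⇒≈ i%n≡r))) jr≈1

module Cayley (m : ℕ) where

  open Modulo m
  open SetoidReasoning ≈-setoid

  Point : Set
  Point = ℕ × ℕ

  infix 4 _≈²_

  _≈²_ : Point → Point → Set
  _≈²_ = Pointwise _≈_ _≈_

  module ≈² = Setoid (×-setoid ≈-setoid ≈-setoid)

  data Aligned (a b : Point) : Set where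
    horizontal : proj₂ a ≈ proj₂ b → Aligned a b
    vertical   : proj₁ a ≈ proj₁ b → Aligned a b
    -- b₁ − a₁ ≈ b₂ − a₂, with the subtractions moved across
    diagonal   : proj₁ a + proj₂ b ≈ proj₁ b + proj₂ a → Aligned a b

  Adjacent : Point → Point → Set
  Adjacent a b = ¬ a ≈² b × Aligned a b

  Aligned-resp-≈² : ∀ {a a′ b b′} → a ≈² a′ → b ≈² b′ → Aligned a b → Aligned a′ b′
  Aligned-resp-≈² (_ , a₂≈) (_ , b₂≈) (horizontal p) = horizontal (≈-trans (≈-sym a₂≈) (≈-trans p b₂≈))
  Aligned-resp-≈² (a₁≈ , _) (b₁≈ , _) (vertical p)   = vertical (≈-trans (≈-sym a₁≈) (≈-trans p b₁≈))
  Aligned-resp-≈² (a₁≈ , a₂≈) (b₁≈ , b₂≈) (diagonal p) =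
    diagonal (≈-trans (+-cong (≈-sym a₁≈) (≈-sym b₂≈)) (≈-trans p (+-cong b₁≈ a₂≈)))

  Adjacent-resp-≈² : ∀ {a a′ b b′} → a ≈² a′ → b ≈² b′ → Adjacent a b → Adjacent a′ b′
  Adjacent-resp-≈² a≈a′ b≈b′ (a≉b , a∥b) =
    (λ a′≈b′ → a≉b (≈².trans a≈a′ (≈².trans a′≈b′ (≈².sym b≈b′)))) , Aligned-resp-≈² a≈a′ b≈b′ a∥b

  rep : G n → Point
  rep = map toℕ toℕ

  ⟦_⟧² : Point → G n
  ⟦_⟧² = map ⟦_⟧ ⟦_⟧

  rep-⟦⟧² : ∀ a → rep ⟦ a ⟧² ≈² a
  rep-⟦⟧² (a₁ , a₂) = toℕ-⟦⟧ a₁ , toℕ-⟦⟧ a₂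

  ⟦⟧²-unique : ∀ {a x} → a ≈² rep x → ⟦ a ⟧² ≡ x
  ⟦⟧²-unique (a₁≈ , a₂≈) = cong₂ _,_ (⟦⟧-unique a₁≈) (⟦⟧-unique a₂≈)

  Adj⇒Adjacent : ∀ {g h} → Adj n g h → Adjacent (rep g) (rep h)
  Adj⇒Adjacent {g₁ , g₂} {h₁ , h₂} (i , 1≤i , i≤m , inj₁ d≡i0) =
    (λ (g₁≈h₁ , _) → +-≈⇒≉ 1≤i i≤m (diffℤn≡⇒+≈ g₁ h₁ (cong proj₁ d≡i0)) g₁≈h₁) ,
    horizontal (diffℤn≡⇒+≈ g₂ h₂ (cong proj₂ d≡i0))
  Adj⇒Adjacent {g₁ , g₂} {h₁ , h₂} (i , 1≤i , i≤m , inj₂ (inj₁ d≡0i)) =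
    (λ (_ , g₂≈h₂) → +-≈⇒≉ 1≤i i≤m (diffℤn≡⇒+≈ g₂ h₂ (cong proj₂ d≡0i)) g₂≈h₂) ,
    vertical (diffℤn≡⇒+≈ g₁ h₁ (cong proj₁ d≡0i))
  Adj⇒Adjacent {g₁ , g₂} {h₁ , h₂} (i , 1≤i , i≤m , inj₂ (inj₂ d≡ii)) =
    (λ (g₁≈h₁ , _) → +-≈⇒≉ 1≤i i≤m i+g₁≈h₁ g₁≈h₁) ,
    diagonal (+-≈-cross i+g₁≈h₁ (diffℤn≡⇒+≈ g₂ h₂ (cong proj₂ d≡ii)))
    where
    i+g₁≈h₁ : i + toℕ g₁ ≈ toℕ h₁
    i+g₁≈h₁ = diffℤn≡⇒+≈ g₁ h₁ (cong proj₁ d≡ii)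

  Adjacent⇒Adj : ∀ {g h} → Adjacent (rep g) (rep h) → Adj n g h
  Adjacent⇒Adj {g₁ , g₂} {h₁ , h₂} (g≉h , horizontal g₂≈h₂) =
    diffℤn g₁ h₁ , diffℤn-positive g₁ h₁ (λ g₁≈h₁ → g≉h (g₁≈h₁ , g₂≈h₂)) , s≤s⁻¹ (diffℤn<n g₁ h₁) ,
    inj₁ (cong (diffℤn g₁ h₁ ,_) (diffℤn-unique g₂ h₂ (s≤s z≤n) g₂≈h₂))
  Adjacent⇒Adj {g₁ , g₂} {h₁ , h₂} (g≉h , vertical g₁≈h₁) =
    diffℤn g₂ h₂ , diffℤn-positive g₂ h₂ (λ g₂≈h₂ → g≉h (g₁≈h₁ , g₂≈h₂)) , s≤s⁻¹ (diffℤn<n g₂ h₂) ,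
    inj₂ (inj₁ (cong (_, diffℤn g₂ h₂) (diffℤn-unique g₁ h₁ (s≤s z≤n) g₁≈h₁)))
  Adjacent⇒Adj {g₁ , g₂} {h₁ , h₂} (g≉h , diagonal g₁+h₂≈h₁+g₂) =
    i , diffℤn-positive g₁ h₁ (λ g₁≈h₁ → g≉h (g₁≈h₁ , +-≈-transfer g₁≈h₁ g₁+h₂≈h₁+g₂)) ,
    s≤s⁻¹ (diffℤn<n g₁ h₁) , inj₂ (inj₂ (cong (i ,_) (diffℤn-unique g₂ h₂ (diffℤn<n g₁ h₁) i+g₂≈h₂)))
    where
    i = diffℤn g₁ h₁
    i+g₂≈h₂ : i + toℕ g₂ ≈ toℕ h₂
    i+g₂≈h₂ = +-≈-transfer (diffℤn-+ g₁ h₁) g₁+h₂≈h₁+g₂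

  record Symmetry : Set where
    field
      to from      : Point → Point
      to-cong      : ∀ {a b} → a ≈² b → to a ≈² to b
      from-cong    : ∀ {a b} → a ≈² b → from a ≈² from b
      to-from      : ∀ a → to (from a) ≈² a
      from-to      : ∀ a → from (to a) ≈² a
      to-aligned   : ∀ {a b} → Aligned a b → Aligned (to a) (to b)
      from-aligned : ∀ {a b} → Aligned a b → Aligned (from a) (from b)

    to≈⇒from≈ : ∀ {a b} → to a ≈² b → from b ≈² a
    to≈⇒from≈ {a} ta≈b = ≈².trans (from-cong (≈².sym ta≈b)) (from-to a)

    to-adjacent : ∀ {a b} → Adjacent a b → Adjacent (to a) (to b)
    to-adjacent {a} (a≉b , a∥b) =
      (λ ta≈tb → a≉b (≈².trans (≈².sym (from-to a)) (to≈⇒from≈ (≈².sym ta≈tb)))) ,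
      to-aligned a∥b

  open Symmetry

  infixr 9 _∘ˢ_

  _∘ˢ_ : Symmetry → Symmetry → Symmetry
  σ ∘ˢ τ = record
    { to           = to σ ∘ to τ
    ; from         = from τ ∘ from σ
    ; to-cong      = to-cong σ ∘ to-cong τ
    ; from-cong    = from-cong τ ∘ from-cong σ
    ; to-from      = λ a → ≈².trans (to-cong σ (to-from τ (from σ a))) (to-from σ a)
    ; from-to      = λ a → ≈².trans (from-cong τ (from-to σ (to τ a))) (from-to τ a)
    ; to-aligned   = to-aligned σ ∘ to-aligned τ
    ; from-aligned = from-aligned τ ∘ from-aligned σ
    }

  _⁻¹ : Symmetry → Symmetry
  σ ⁻¹ = record
    { to         = from σ         ; from         = to σ
    ; to-cong    = from-cong σ    ; from-cong    = to-cong σ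
    ; to-from    = from-to σ      ; from-to      = to-from σ
    ; to-aligned = from-aligned σ ; from-aligned = to-aligned σ
    }

  involution : (f : Point → Point) → (∀ {a b} → a ≈² b → f a ≈² f b) → (∀ a → f (f a) ≈² a) →
               (∀ {a b} → Aligned a b → Aligned (f a) (f b)) → Symmetry
  involution f f-cong f-f f-aligned = record
    { to = f ; from = f ; to-cong = f-cong ; from-cong = f-cong
    ; to-from = f-f ; from-to = f-f ; to-aligned = f-aligned ; from-aligned = f-aligned
    }

  translate : Point → Point → Point
  translate (t₁ , t₂) (x₁ , x₂) = x₁ + t₁ , x₂ + t₂

  translate-cong : ∀ t {a b} → a ≈² b → translate t a ≈² translate t b
  translate-cong t (a₁≈b₁ , a₂≈b₂) = +-cong a₁≈b₁ ≈-refl , +-cong a₂≈b₂ ≈-refl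

  translate-aligned : ∀ t {a b} → Aligned a b → Aligned (translate t a) (translate t b)
  translate-aligned t (horizontal p) = horizontal (+-cong p ≈-refl)
  translate-aligned t (vertical p)   = vertical (+-cong p ≈-refl)
  translate-aligned (t₁ , t₂) {a₁ , a₂} {b₁ , b₂} (diagonal p) = diagonal (begin
    (a₁ + t₁) + (b₂ + t₂)    ≡⟨ interchange a₁ t₁ b₂ t₂ ⟩
    (a₁ + b₂) + (t₁ + t₂)    ≈⟨ +-cong p ≈-refl ⟩
    (b₁ + a₂) + (t₁ + t₂)    ≡⟨ interchange b₁ a₂ t₁ t₂ ⟩
    (b₁ + t₁) + (a₂ + t₂)    ∎)

  translate-cancel : ∀ t s → proj₁ t + proj₁ s ≈ 0 → proj₂ t + proj₂ s ≈ 0 →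
                     ∀ a → translate s (translate t a) ≈² a
  translate-cancel (t₁ , t₂) (s₁ , s₂) t₁+s₁≈0 t₂+s₂≈0 (a₁ , a₂) = cancel t₁+s₁≈0 , cancel t₂+s₂≈0
    where
    cancel : ∀ {t s x} → t + s ≈ 0 → x + t + s ≈ x
    cancel {t} {s} {x} t+s≈0 =
      ≈-trans (≡⇒≈ (+-assoc x t s)) (≈-trans (+-cong (≈-refl {x}) t+s≈0) (≡⇒≈ (+-identityʳ x)))

  translation : Point → Symmetry
  translation t@(t₁ , t₂) = record
    { to = translate t ; from = translate -t
    ; to-cong = translate-cong t ; from-cong = translate-cong -t
    ; to-from = translate-cancel -t t (⊖-+ t₁ 0) (⊖-+ t₂ 0)
    ; from-to = translate-cancel t -t (+-⊖≈0 t₁) (+-⊖≈0 t₂)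
    ; to-aligned = translate-aligned t ; from-aligned = translate-aligned -t
    }
    where
    -t = 0 ⊖ t₁ , 0 ⊖ t₂
    +-⊖≈0 : ∀ a → a + (0 ⊖ a) ≈ 0
    +-⊖≈0 a = ≈-trans (≡⇒≈ (+-comm a (0 ⊖ a))) (⊖-+ a 0)

  scale : ℕ → Point → Point
  scale i (x₁ , x₂) = x₁ * i , x₂ * i

  scale-cong : ∀ i {a b} → a ≈² b → scale i a ≈² scale i b
  scale-cong i (a₁≈b₁ , a₂≈b₂) = *-cong a₁≈b₁ ≈-refl , *-cong a₂≈b₂ ≈-refl

  scale-aligned : ∀ i {a b} → Aligned a b → Aligned (scale i a) (scale i b)
  scale-aligned i (horizontal p) = horizontal (*-cong p ≈-refl)
  scale-aligned i (vertical p)   = vertical (*-cong p ≈-refl)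
  scale-aligned i {a₁ , a₂} {b₁ , b₂} (diagonal p) = diagonal (begin
    a₁ * i + b₂ * i    ≡⟨ *-distribʳ-+ i a₁ b₂ ⟨
    (a₁ + b₂) * i      ≈⟨ *-cong p ≈-refl ⟩
    (b₁ + a₂) * i      ≡⟨ *-distribʳ-+ i b₁ a₂ ⟩
    b₁ * i + a₂ * i    ∎)

  scale-cancel : ∀ i j → i * j ≈ 1 → ∀ a → scale j (scale i a) ≈² a
  scale-cancel i j i*j≈1 (a₁ , a₂) = cancel a₁ , cancel a₂
    where
    cancel : ∀ x → x * i * j ≈ x
    cancel x = ≈-trans (≡⇒≈ (*-assoc x i j)) (≈-trans (*-cong (≈-refl {x}) i*j≈1) (≡⇒≈ (*-identityʳ x)))

  scaling : ∀ i j → j * i ≈ 1 → Symmetry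
  scaling i j j*i≈1 = record
    { to = scale i ; from = scale j
    ; to-cong = scale-cong i ; from-cong = scale-cong j
    ; to-from = scale-cancel j i j*i≈1
    ; from-to = scale-cancel i j (≈-trans (≡⇒≈ (*-comm i j)) j*i≈1)
    ; to-aligned = scale-aligned i ; from-aligned = scale-aligned j
    }

  swap-aligned : ∀ {a b} → Aligned a b → Aligned (swap a) (swap b)
  swap-aligned (horizontal p) = vertical p
  swap-aligned (vertical p)   = horizontal p
  swap-aligned {a₁ , a₂} {b₁ , b₂} (diagonal p) =
    diagonal (≈-trans (≡⇒≈ (+-comm a₂ b₁)) (≈-trans (≈-sym p) (≡⇒≈ (+-comm a₁ b₂))))

  swapping : Symmetry
  swapping = involution swap (λ (p , q) → q , p) (λ _ → ≈².refl) swap-aligned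

  shear : Point → Point
  shear (x₁ , x₂) = x₁ , x₁ ⊖ x₂

  shear-cong : ∀ {a b} → a ≈² b → shear a ≈² shear b
  shear-cong (a₁≈b₁ , a₂≈b₂) = a₁≈b₁ , +-cong a₁≈b₁ (*-cong a₂≈b₂ ≈-refl)

  shear-aligned : ∀ {a b} → Aligned a b → Aligned (shear a) (shear b)
  shear-aligned {a₁ , a₂} {b₁ , b₂} (horizontal a₂≈b₂) = diagonal (begin
    a₁ + (b₁ + b₂ * m)    ≡⟨ x∙yz≈y∙xz a₁ b₁ (b₂ * m) ⟩
    b₁ + (a₁ + b₂ * m)    ≈⟨ +-cong (≈-refl {b₁}) (+-cong (≈-refl {a₁}) (*-cong a₂≈b₂ ≈-refl)) ⟨
    b₁ + (a₁ + a₂ * m)    ∎)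
  shear-aligned (vertical p)   = vertical p
  shear-aligned {a₁ , a₂} {b₁ , b₂} (diagonal p) = horizontal (+-≈-cross⇒⊖-≈ {a₁} {a₂} {b₁} {b₂} p)

  shearing : Symmetry
  shearing = involution shear shear-cong (λ (a₁ , a₂) → ≈-refl {a₁} , ⊖-involutive a₁ a₂) shear-aligned

  dilation : Prime n → ∀ {i} → i ≉ 0 → Point → Symmetry
  dilation p {i} i≉0 a = let j , j*i≈1 = prime⇒invertible p i≉0 in translation a ∘ˢ scaling i j j*i≈1

  arc-from-base : Prime n → ∀ {a b} → Adjacent a b →
                  Σ[ σ ∈ Symmetry ] to σ (0 , 0) ≈² a × to σ (1 , 0) ≈² b
  arc-from-base p {a₁ , a₂} {b₁ , b₂} (a≉b , horizontal a₂≈b₂) =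
    dilation p (⊖≉0 {a₁} {b₁} (λ a₁≈b₁ → a≉b (a₁≈b₁ , a₂≈b₂))) (a₁ , a₂) ,
    ≈².refl , (1*i+a≈b (b₁ ⊖ a₁) (⊖-+ a₁ b₁) , a₂≈b₂)
  arc-from-base p {a₁ , a₂} {b₁ , b₂} (a≉b , vertical a₁≈b₁) =
    dilation p (⊖≉0 {a₂} {b₂} (λ a₂≈b₂ → a≉b (a₁≈b₁ , a₂≈b₂))) (a₁ , a₂) ∘ˢ swapping ,
    ≈².refl , (a₁≈b₁ , 1*i+a≈b (b₂ ⊖ a₂) (⊖-+ a₂ b₂))
  arc-from-base p {a₁ , a₂} {b₁ , b₂} (a≉b , diagonal a₁+b₂≈b₁+a₂) =
    dilation p (⊖≉0 {a₁} {b₁} (λ a₁≈b₁ → a≉b (a₁≈b₁ , +-≈-transfer a₁≈b₁ a₁+b₂≈b₁+a₂))) (a₁ , a₂)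
      ∘ˢ shearing ,
    ≈².refl ,
    (1*i+a≈b (b₁ ⊖ a₁) (⊖-+ a₁ b₁) , 1*i+a≈b (b₁ ⊖ a₁) (+-≈-transfer (⊖-+ a₁ b₁) a₁+b₂≈b₁+a₂))

  arc-transitive : Prime n → ∀ {a b c d} → Adjacent a b → Adjacent c d →
                   Σ[ σ ∈ Symmetry ] to σ a ≈² c × to σ b ≈² d
  arc-transitive p a∼b c∼d =
    let σ , σ0≈a , σ1≈b = arc-from-base p a∼b
        τ , τ0≈c , τ1≈d = arc-from-base p c∼d
    in τ ∘ˢ σ ⁻¹ , ≈².trans (to-cong τ (to≈⇒from≈ σ σ0≈a)) τ0≈c ,
                   ≈².trans (to-cong τ (to≈⇒from≈ σ σ1≈b)) τ1≈d

  act : Symmetry → G n → G n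
  act σ = ⟦_⟧² ∘ to σ ∘ rep

  act-inverse : ∀ σ x → act σ (act (σ ⁻¹) x) ≡ x
  act-inverse σ x = ⟦⟧²-unique (≈².trans (to-cong σ (rep-⟦⟧² _)) (to-from σ (rep x)))

  act-Adj : ∀ σ {u v} → Adj n u v → Adj n (act σ u) (act σ v)
  act-Adj σ = Adjacent⇒Adj ∘ Adjacent-resp-≈² (rep-act _) (rep-act _) ∘ to-adjacent σ ∘ Adj⇒Adjacent
    where
    rep-act : ∀ a → a ≈² rep ⟦ a ⟧²
    rep-act a = ≈².sym (rep-⟦⟧² a)

  lift : Symmetry → G n ↔ G n
  lift σ = mk↔ₛ′ (act σ) (act (σ ⁻¹)) (act-inverse σ) (act-inverse (σ ⁻¹))

  lift-isAutomorphism : ∀ σ → IsAutomorphism (Adj n) (↔⇒⤖ (lift σ))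
  lift-isAutomorphism σ u v =
    mk⇔ (act-Adj σ) (subst₂ (Adj n) (act-inverse (σ ⁻¹) u) (act-inverse (σ ⁻¹) v) ∘ act-Adj (σ ⁻¹))

theorem3p2 : (n : ℕ) → 4 ≤ n → Prime n → ArcTransitive (Adj n)
theorem3p2 zero    () _
theorem3p2 (suc m) _  p u v x y u∼v x∼y =
  let σ , σu≈x , σv≈y = arc-transitive p (Adj⇒Adjacent {u} {v} u∼v) (Adj⇒Adjacent {x} {y} x∼y)
  in ↔⇒⤖ (lift σ) , lift-isAutomorphism σ , ⟦⟧²-unique σu≈x , ⟦⟧²-unique σv≈y
  where open Cayley m
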